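{- There is an absolute constant $c$ such that the following holds. Fix $r,k,t\in\mathbb N$. Let $V$ be a finite set equipped with: (i) a binary relation $E\subseteq V\times V$ such that for all $A\subseteq V$ and $B\subseteq V$, the relation $E\cap(A\times B)\subseteq A\times B$ has a duality of order $k$; (ii) a pseudometric $\mathrm{dist}\colon V\times V\to\mathbb R_{\ge0}\cup\{+\infty\}$; (iii) a partition $\mathcal P$ of $V$ with $|\mathcal P|\le t$; such that whenever $u,v,u',v'\in V$ satisfy $\mathrm{dist}(u,v)>r$, $\mathrm{dist}(u',v')>r$, $C(u)=C(u')$ and $C(v)=C(v')$, we have $(u,v)\in E\iff(u',v')\in E$. Then there is a set $S\subseteq V$ with $|S|\le c\cdot k t^2$ such that whenever $u,v,u',v'\in V$ satisfy $\mathrm{dist}(u,v)>5r$, $\mathrm{dist}(u',v')>5r$, $E(u,S)=E(u',S)$ and $E(S,v)=E(S,v')$, we have $(u,v)\in E\iff(u',v')\in E$.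
   Context: A pseudometric here is a symmetric function $V\times V\to\mathbb R_{\ge0}\cup\{+\infty\}$ satisfying the triangle inequality. For $v\in V$, $C(v)$ denotes the unique part of $\mathcal P$ containing $v$. $E(u,S)=\{s\in S:(u,s)\in E\}$ and $E(S,v)=\{s\in S:(s,v)\in E\}$. A relation $R\subseteq A\times B$ has a duality of order $k$ if (a) there is $A'\subseteq A$, $|A'|\le k$, such that for every $b\in B$ some $a\in A'$ has $(a,b)\notin R$, or (b) there is $B'\subseteq B$, $|B'|\le k$, such that for every $a\in A$ some $b\in B'$ has $(a,b)\in R$.
   Formalization: The pseudometric $\mathrm{dist}$ takes values only in ℚ≥0 ∪ {+∞} instead of $\mathbb R_{\ge0}\cup\{+\infty\}$. -}

module Defs where

open import Data.Nat using (ℕ; _*_)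
open import Data.Integer using (+_)
open import Data.Rational using (ℚ; 0ℚ; _/_) renaming (_+_ to _+ℚ_; _≤_ to _≤ℚ_; _<_ to _<ℚ_)
open import Data.Fin using (Fin)
open import Data.Fin.Subset using (Subset; _∈_; _⊆_; ∣_∣)
open import Data.Bool using (Bool; true; false)
open import Data.Product using (Σ; ∃; _×_; _,_)
open import Data.Sum using (_⊎_)
open import Data.Unit using (⊤)
open import Data.Empty using (⊥)
open import Relation.Binary.PropositionalEquality using (_≡_)

data ℚ∞ : Set where
  fin : ℚ → ℚ∞
  ∞   : ℚ∞

_+∞_ : ℚ∞ → ℚ∞ → ℚ∞
fin x +∞ fin y = fin (x +ℚ y)
fin x +∞ ∞ = ∞
∞ +∞ y = ∞

_≤∞_ : ℚ∞ → ℚ∞ → Set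
fin x ≤∞ fin y = x ≤ℚ y
fin x ≤∞ ∞ = ⊤
∞ ≤∞ fin y = ⊥
∞ ≤∞ ∞ = ⊤

_<∞_ : ℚ → ℚ∞ → Set
q <∞ fin x = q <ℚ x
q <∞ ∞ = ⊤

ℕ→ℚ : ℕ → ℚ
ℕ→ℚ m = + m / 1

record IsPseudometric {n : ℕ} (dist : Fin n → Fin n → ℚ∞) : Set where
  field
    nonneg : ∀ u v → fin 0ℚ ≤∞ dist u v
    sym    : ∀ u v → dist u v ≡ dist v u
    tri    : ∀ u v w → dist u w ≤∞ (dist u v +∞ dist v w)

HasDuality : {n : ℕ} → (Fin n → Fin n → Bool) → Subset n → Subset n → ℕ → Set
HasDuality {n} E A B k =
    (Σ (Subset n) λ A' → A' ⊆ A × ∣ A' ∣ Data.Nat.≤ k ×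
       (∀ b → b ∈ B → Σ (Fin n) λ a → a ∈ A' × E a b ≡ false))
  ⊎ (Σ (Subset n) λ B' → B' ⊆ B × ∣ B' ∣ Data.Nat.≤ k ×
       (∀ a → a ∈ A → Σ (Fin n) λ b → b ∈ B' × E a b ≡ true))

{-# OPTIONS --safe #-}
-- Call x, y m-far when dist(x, y) > m·r. Each part p of the partition gets at most three
-- representatives: either three pairwise 2-far points of p (any two points are then both 1-far
-- from one of them), or at most two points within 2r of which all of p lies. The cells of p are
-- p itself and the 2r-balls in p around its representatives, and S consists of the representatives
-- together with a duality witness of size ≤ k for every pair of cells: |S| ≤ t²(3 + 16k) ≤ 19kt².
-- For 5r-far pairs (u, v), (u′, v′) agreeing on S: a representative of C(x) that is r-far from
-- both v and v′ carries the agreement E(S, v) = E(S, v′) over to E(x, v) = E(x, v′) whenever x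
-- is 3r-far from v and v′, and symmetrically for rows; this settles the case where u is 3r-far
-- from v′ or u′ from v. Otherwise u, u′ and v, v′ are 2r-far. If E(u, v) holds but E(u′, v′)
-- fails, some cell A ∋ u has every a ∈ A adjacent to v or v′, and some cell B ∋ v′ has every
-- b ∈ B non-adjacent to u or u′; both alternatives of the duality witness for A × B, which lies
-- in S, contradict this.
module Submission where

open import Defs
open import Level using (_⊔_)
open import Data.Nat using (ℕ; zero; suc; _*_; _+_; _≤_; _<_; z≤n; s≤s)
import Data.Nat.Properties as ℕ
open import Data.Nat.Coprimality as Coprime using (1-coprimeTo)
open import Data.Nat.Tactic.RingSolver using (solve-∀)
open import Data.Integer as ℤ using (+_)
import Data.Integer.Properties as ℤ
open import Data.Rational using (mkℚ; _/_; *≤*) renaming (_+_ to _+ℚ_; _≤_ to _≤ℚ_)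
import Data.Rational.Properties as ℚP
open import Data.Bool using (Bool; true; false)
open import Data.Fin using (Fin; zero; suc; _≟_)
open import Data.Fin.Properties using (any?)
open import Data.Fin.Subset using (Subset; _∈_; _⊆_; ∣_∣; _∪_; ⋃; ⁅_⁆; ⊤)
open import Data.Fin.Subset.Properties
  using (p⊆p∪q; q⊆p∪q; ∣⊥∣≡0; ∣⁅x⁆∣≡1; x∈⁅x⁆; x∈p⇒∣p-x∣<∣p∣; ∈⊤)
import Data.List as List
open import Data.Vec using (_∷_; []; lookup; tabulate)
open import Data.Vec.Properties using ([]=⇒lookup; lookup⇒[]=; lookup∘tabulate)
open import Data.Product using (Σ; Σ-syntax; _×_; _,_; proj₁; proj₂)
open import Data.Sum using (_⊎_; inj₁; inj₂; [_,_]′)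
open import Data.Unit using (tt)
open import Data.Empty using (⊥; ⊥-elim)
open import Function using (_∘_; flip)
open import Relation.Nullary using (Dec; yes; no; does; ¬_)
open import Relation.Nullary.Decidable using (dec-true; _×-dec_; ¬?)
open import Relation.Unary using (Pred; Decidable)
open import Relation.Binary using (Rel; Symmetric) renaming (Decidable to Decidable₂)
open import Relation.Binary.PropositionalEquality

ℕ→ℚ≡mkℚ : ∀ m → ℕ→ℚ m ≡ mkℚ (+ m) 0 (Coprime.sym (1-coprimeTo m))
ℕ→ℚ≡mkℚ m = ℚP.normalize-coprime (Coprime.sym (1-coprimeTo m))

ℕ→ℚ-mono-≤ : ∀ {m n} → m ≤ n → ℕ→ℚ m ≤ℚ ℕ→ℚ n
ℕ→ℚ-mono-≤ {m} {n} m≤n rewrite ℕ→ℚ≡mkℚ m | ℕ→ℚ≡mkℚ n =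
  *≤* (subst₂ ℤ._≤_ (sym (ℤ.*-identityʳ (+ m))) (sym (ℤ.*-identityʳ (+ n))) (ℤ.+≤+ m≤n))

ℕ→ℚ-homo-+ : ∀ m n → ℕ→ℚ (m + n) ≡ ℕ→ℚ m +ℚ ℕ→ℚ n
ℕ→ℚ-homo-+ m n = begin
  (+ m ℤ.+ + n) / 1                 ≡⟨ ℚP./-cong (sym (cong₂ ℤ._+_ (ℤ.*-identityʳ (+ m)) (ℤ.*-identityʳ (+ n)))) refl ⟩
  (+ m ℤ.* + 1 ℤ.+ + n ℤ.* + 1) / 1 ≡⟨ cong₂ _+ℚ_ (ℕ→ℚ≡mkℚ m) (ℕ→ℚ≡mkℚ n) ⟨
  ℕ→ℚ m +ℚ ℕ→ℚ n                   ∎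
  where open ≡-Reasoning

<∞? : ∀ q d → Dec (q <∞ d)
<∞? q (fin x) = q ℚP.<? x
<∞? q ∞       = yes tt

≤-<∞-trans : ∀ {p q} d → p ≤ℚ q → q <∞ d → p <∞ d
≤-<∞-trans (fin x) p≤q q<x = ℚP.≤-<-trans p≤q q<x
≤-<∞-trans ∞       _   _   = tt

≮∞⇒≥∞ : ∀ {q} d → ¬ (q <∞ d) → d ≤∞ fin q
≮∞⇒≥∞ (fin x) q≮x = ℚP.≮⇒≥ q≮x
≮∞⇒≥∞ ∞       q≮∞ = q≮∞ tt

≤∞⇒≯∞ : ∀ {q} d → d ≤∞ fin q → ¬ (q <∞ d)
≤∞⇒≯∞ (fin x) x≤q q<x = ℚP.<-irrefl refl (ℚP.<-≤-trans q<x x≤q)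

≤∞-trans : ∀ {d e f} → d ≤∞ e → e ≤∞ f → d ≤∞ f
≤∞-trans {fin _} {fin _} {fin _} = ℚP.≤-trans
≤∞-trans {fin _} {_}     {∞}     _ _ = tt
≤∞-trans {∞}     {∞}     {∞}     _ _ = tt
≤∞-trans {fin _} {∞}     {fin _} _ ()
≤∞-trans {∞}     {fin _} ()

+∞-mono-≤∞ : ∀ {d e p q} → d ≤∞ fin p → e ≤∞ fin q → (d +∞ e) ≤∞ fin (p +ℚ q)
+∞-mono-≤∞ {fin _} {fin _} = ℚP.+-mono-≤

-- `Far m x y` stands for dist(x, y) > m·r; these are the only properties of the pseudometric used.
record Farness (n : ℕ) : Set₁ where
  field
    Far          : ℕ → Fin n → Fin n → Set
    far?         : ∀ m x y → Dec (Far m x y)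
    far-sym      : ∀ {m x y} → Far m x y → Far m y x
    far-antitone : ∀ {m m′ x y} → m′ ≤ m → Far m x y → Far m′ x y
    far-split    : ∀ a b {x} y {z} → Far (a + b) x z → Far a x y ⊎ Far b y z

  near-trans : ∀ a b {x y z} → ¬ Far a x y → ¬ Far b y z → ¬ Far (a + b) x z
  near-trans a b {y = y} ¬xy ¬yz xz = [ ¬xy , ¬yz ]′ (far-split a b y xz)

  far-from-one-of : ∀ {x y} → Far 2 x y → ∀ w → Far 1 x w ⊎ Far 1 y w
  far-from-one-of xy w with far-split 1 1 w xy
  ... | inj₁ xw = inj₁ xw
  ... | inj₂ wy = inj₂ (far-sym wy)

  triangle-far-from-both : ∀ {x y z} → Far 2 x y → Far 2 x z → Far 2 y z → ∀ w w′ →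
    Σ (Fin 3) λ ι → let s = lookup (x ∷ y ∷ z ∷ []) ι in Far 1 s w × Far 1 s w′
  triangle-far-from-both xy xz yz w w′ with far-from-one-of xy w | far-from-one-of xy w′
  ... | inj₁ xw | inj₁ xw′ = zero , xw , xw′
  ... | inj₂ yw | inj₂ yw′ = suc zero , yw , yw′
  ... | inj₁ xw | inj₂ yw′ with far-from-one-of yz w | far-from-one-of xz w′
  ...   | inj₁ yw | _        = suc zero , yw , yw′
  ...   | inj₂ zw | inj₁ xw′ = zero , xw , xw′
  ...   | inj₂ zw | inj₂ zw′ = suc (suc zero) , zw , zw′
  triangle-far-from-both xy xz yz w w′ | inj₂ yw | inj₁ xw′ with far-from-one-of xz w | far-from-one-of yz w′
  ...   | inj₁ xw | _        = zero , xw , xw′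
  ...   | inj₂ zw | inj₁ yw′ = suc zero , yw , yw′
  ...   | inj₂ zw | inj₂ zw′ = suc (suc zero) , zw , zw′

pseudometricFarness : ∀ {n} {dist : Fin n → Fin n → ℚ∞} → IsPseudometric dist → ℕ → Farness n
pseudometricFarness {n} {dist} pm r = record
  { Far          = Far
  ; far?         = λ m x y → <∞? (ℕ→ℚ (m * r)) (dist x y)
  ; far-sym      = λ {m} {x} {y} → subst (ℕ→ℚ (m * r) <∞_) (dist-sym x y)
  ; far-antitone = λ {x = x} {y} m′≤m → ≤-<∞-trans (dist x y) (ℕ→ℚ-mono-≤ (ℕ.*-monoˡ-≤ r m′≤m))
  ; far-split    = far-split
  }
  where
  open IsPseudometric pm renaming (sym to dist-sym)

  Far : ℕ → Fin n → Fin n → Set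
  Far m x y = ℕ→ℚ (m * r) <∞ dist x y

  triangle-inequality : ∀ a b {x} y {z} → ¬ Far a x y → ¬ Far b y z → ¬ Far (a + b) x z
  triangle-inequality a b {x} y {z} ¬xy ¬yz = ≤∞⇒≯∞ (dist x z) (≤∞-trans (tri x y z) legs)
    where
    radius : ℕ→ℚ (a * r) +ℚ ℕ→ℚ (b * r) ≡ ℕ→ℚ ((a + b) * r)
    radius = trans (sym (ℕ→ℚ-homo-+ (a * r) (b * r))) (cong ℕ→ℚ (sym (ℕ.*-distribʳ-+ r a b)))

    legs : (dist x y +∞ dist y z) ≤∞ fin (ℕ→ℚ ((a + b) * r))
    legs = subst (λ q → (dist x y +∞ dist y z) ≤∞ fin q) radius
      (+∞-mono-≤∞ (≮∞⇒≥∞ (dist x y) ¬xy) (≮∞⇒≥∞ (dist y z) ¬yz))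

  far-split : ∀ a b {x} y {z} → Far (a + b) x z → Far a x y ⊎ Far b y z
  far-split a b {x} y {z} xz with <∞? (ℕ→ℚ (a * r)) (dist x y) | <∞? (ℕ→ℚ (b * r)) (dist y z)
  ... | yes xy | _      = inj₁ xy
  ... | no _   | yes yz = inj₂ yz
  ... | no ¬xy | no ¬yz = ⊥-elim (triangle-inequality a b y ¬xy ¬yz xz)

far₁⇒r<dist : ∀ {n} {dist : Fin n → Fin n → ℚ∞} (pm : IsPseudometric dist) r {x y} →
  Farness.Far (pseudometricFarness pm r) 1 x y → ℕ→ℚ r <∞ dist x y
far₁⇒r<dist {dist = dist} _ r {x} {y} = subst (λ m → ℕ→ℚ m <∞ dist x y) (ℕ.*-identityˡ r)

true≢false : true ≢ false
true≢false ()

common-value : ∀ {a} {A : Set a} {x y c d : A} → x ≡ c ⊎ y ≡ c → x ≡ d → y ≡ d → c ≡ d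
common-value (inj₁ x≡c) x≡d _   = trans (sym x≡c) x≡d
common-value (inj₂ y≡c) _   y≡d = trans (sym y≡c) y≡d

∣p∪q∣≤∣p∣+∣q∣ : ∀ {n} (p q : Subset n) → ∣ p ∪ q ∣ ≤ ∣ p ∣ + ∣ q ∣
∣p∪q∣≤∣p∣+∣q∣ []          []          = z≤n
∣p∪q∣≤∣p∣+∣q∣ (true ∷ p)  (true ∷ q)  = s≤s (ℕ.≤-trans (∣p∪q∣≤∣p∣+∣q∣ p q) (ℕ.+-monoʳ-≤ ∣ p ∣ (ℕ.n≤1+n ∣ q ∣)))
∣p∪q∣≤∣p∣+∣q∣ (true ∷ p)  (false ∷ q) = s≤s (∣p∪q∣≤∣p∣+∣q∣ p q)
∣p∪q∣≤∣p∣+∣q∣ (false ∷ p) (true ∷ q)  = ℕ.≤-trans (s≤s (∣p∪q∣≤∣p∣+∣q∣ p q)) (ℕ.≤-reflexive (sym (ℕ.+-suc ∣ p ∣ ∣ q ∣)))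
∣p∪q∣≤∣p∣+∣q∣ (false ∷ p) (false ∷ q) = ∣p∪q∣≤∣p∣+∣q∣ p q

x∈p⇒0<∣p∣ : ∀ {n} {x : Fin n} {p} → x ∈ p → 0 < ∣ p ∣
x∈p⇒0<∣p∣ x∈p = ℕ.≤-<-trans z≤n (x∈p⇒∣p-x∣<∣p∣ x∈p)

⋃ᶠ : ∀ {n m} → (Fin m → Subset n) → Subset n
⋃ᶠ f = ⋃ (List.tabulate f)

f⊆⋃ᶠf : ∀ {n m} (f : Fin m → Subset n) i → f i ⊆ ⋃ᶠ f
f⊆⋃ᶠf f zero    = p⊆p∪q (⋃ᶠ (f ∘ suc))
f⊆⋃ᶠf f (suc i) = q⊆p∪q (f zero) (⋃ᶠ (f ∘ suc)) ∘ f⊆⋃ᶠf (f ∘ suc) i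

∣⋃ᶠ∣≤ : ∀ {n m} (f : Fin m → Subset n) {b} → (∀ i → ∣ f i ∣ ≤ b) → ∣ ⋃ᶠ f ∣ ≤ m * b
∣⋃ᶠ∣≤ {n} {zero}  f _    = ℕ.≤-reflexive (∣⊥∣≡0 n)
∣⋃ᶠ∣≤ {n} {suc m} f ∣f∣≤b = ℕ.≤-trans (∣p∪q∣≤∣p∣+∣q∣ (f zero) (⋃ᶠ (f ∘ suc)))
  (ℕ.+-mono-≤ (∣f∣≤b zero) (∣⋃ᶠ∣≤ (f ∘ suc) (∣f∣≤b ∘ suc)))

module _ {n ℓ} {P : Pred (Fin n) ℓ} (P? : Decidable P) where

  toSubset : Subset n
  toSubset = tabulate (does ∘ P?)

  ∈-toSubset⁺ : ∀ {x} → P x → x ∈ toSubset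
  ∈-toSubset⁺ {x} px = lookup⇒[]= x toSubset (trans (lookup∘tabulate (does ∘ P?) x) (dec-true (P? x) px))

  ∈-toSubset⁻ : ∀ {x} → x ∈ toSubset → P x
  ∈-toSubset⁻ {x} x∈ with P? x | trans (sym (lookup∘tabulate (does ∘ P?) x)) ([]=⇒lookup x∈)
  ... | yes px | _ = px
  ... | no _   | ()

module _ {n k : ℕ} {E : Fin n → Fin n → Bool} {A B : Subset n} where

  witness : HasDuality E A B k → Subset n
  witness (inj₁ (A′ , _)) = A′
  witness (inj₂ (B′ , _)) = B′

  ∣witness∣≤k : (d : HasDuality E A B k) → ∣ witness d ∣ ≤ k
  ∣witness∣≤k (inj₁ (_ , _ , ∣A′∣≤k , _)) = ∣A′∣≤k
  ∣witness∣≤k (inj₂ (_ , _ , ∣B′∣≤k , _)) = ∣B′∣≤k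

  witness-separates : (d : HasDuality E A B k) →
    (∀ b → b ∈ B → Σ (Fin n) λ a → a ∈ witness d × a ∈ A × E a b ≡ false) ⊎
    (∀ a → a ∈ A → Σ (Fin n) λ b → b ∈ witness d × b ∈ B × E a b ≡ true)
  witness-separates (inj₁ (_ , A′⊆A , _ , sep)) =
    inj₁ λ b b∈B → let a , a∈A′ , Eab = sep b b∈B in a , a∈A′ , A′⊆A a∈A′ , Eab
  witness-separates (inj₂ (_ , B′⊆B , _ , sep)) =
    inj₂ λ a a∈A → let b , b∈B′ , Eab = sep a a∈A in b , b∈B′ , B′⊆B b∈B′ , Eab

duality-order-positive : ∀ {n k} {E : Fin n → Fin n → Bool} → Fin n → HasDuality E ⊤ ⊤ k → 0 < k
duality-order-positive x (inj₁ (_ , _ , ∣A′∣≤k , sep)) =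
  let _ , a∈A′ , _ = sep x ∈⊤ in ℕ.<-≤-trans (x∈p⇒0<∣p∣ a∈A′) ∣A′∣≤k
duality-order-positive x (inj₂ (_ , _ , ∣B′∣≤k , sep)) =
  let _ , b∈B′ , _ = sep x ∈⊤ in ℕ.<-≤-trans (x∈p⇒0<∣p∣ b∈B′) ∣B′∣≤k

module _ {n a r} (P : Pred (Fin n) a) (R : Rel (Fin n) r) where

  Triangle : Set (a ⊔ r)
  Triangle = Σ[ x ∈ Fin n ] Σ[ y ∈ Fin n ] Σ[ z ∈ Fin n ] (P x × P y × P z) × R x y × R x z × R y z

  Net : (Fin 3 → Fin n) → Set (a ⊔ r)
  Net pt = ∀ z → P z → Σ (Fin 3) λ ι → P (pt ι) × ¬ R z (pt ι)

triangle-or-net : ∀ {n a r} {P : Pred (Fin n) a} {R : Rel (Fin n) r} →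
  Decidable P → Decidable₂ R → Symmetric R → Fin n → Triangle P R ⊎ Σ (Fin 3 → Fin n) (Net P R)
triangle-or-net {n} {P = P} {R} P? R? R-sym x₀
  with any? (λ x → any? λ y → any? λ z → (P? x ×-dec P? y ×-dec P? z) ×-dec R? x y ×-dec R? x z ×-dec R? y z)
... | yes (x , y , z , triangle) = inj₁ (x , y , z , triangle)
... | no no-triangle with any? (λ x → any? λ y → (P? x ×-dec P? y) ×-dec R? x y)
...   | yes (x , y , (px , py) , xy) = inj₂ (lookup (x ∷ y ∷ y ∷ []) , pair-net)
  where
  pair-net : Net P R (lookup (x ∷ y ∷ y ∷ []))
  pair-net z pz with R? z x | R? z y
  ... | no ¬zx | _      = zero , px , ¬zx
  ... | yes _  | no ¬zy = suc zero , py , ¬zy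
  ... | yes zx | yes zy = ⊥-elim (no-triangle (x , y , z , (px , py , pz) , xy , R-sym zx , R-sym zy))
...   | no no-pair with any? P?
...     | yes (x , px) = inj₂ ((λ _ → x) , λ z pz → zero , px , λ zx → no-pair (z , x , (pz , px) , zx))
...     | no empty     = inj₂ ((λ _ → x₀) , λ z pz → ⊥-elim (empty (z , pz)))

module ClassDeterminacy {n t} (F : Farness n) (C : Fin n → Fin t) where
  open Farness F

  ClassDetermined : (Fin n → Fin n → Bool) → Set
  ClassDetermined E = ∀ {x y x′ y′} → Far 1 x y → Far 1 x′ y′ → C x ≡ C x′ → C y ≡ C y′ → E x y ≡ E x′ y′

  transpose-classDetermined : ∀ {E} → ClassDetermined E → ClassDetermined (flip E)
  transpose-classDetermined det xy x′y′ cx cy = det (far-sym xy) (far-sym x′y′) cy cx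

module Cells {n t} (F : Farness n) (C : Fin n → Fin t) (x₀ : Fin n) where
  open Farness F
  open ClassDeterminacy F C

  Wide : Fin t → (Fin 3 → Fin n) → Set
  Wide p pt = (∀ ι → C (pt ι) ≡ p) × (∀ w w′ → Σ (Fin 3) λ ι → Far 1 (pt ι) w × Far 1 (pt ι) w′)

  representatives : ∀ p → Σ (Fin 3 → Fin n) λ pt → Wide p pt ⊎ Net (λ z → C z ≡ p) (Far 2) pt
  representatives p with triangle-or-net (λ z → C z ≟ p) (far? 2) far-sym x₀
  ... | inj₁ (x , y , z , (cx , cy , cz) , xy , xz , yz) =
    lookup (x ∷ y ∷ z ∷ []) ,
    inj₁ ((λ { zero → cx ; (suc zero) → cy ; (suc (suc zero)) → cz }) , triangle-far-from-both xy xz yz)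
  ... | inj₂ (pt , net) = pt , inj₂ net

  reps : Fin t → Fin 3 → Fin n
  reps p = proj₁ (representatives p)

  reps-wide-or-net : ∀ p → Wide p (reps p) ⊎ Net (λ z → C z ≡ p) (Far 2) (reps p)
  reps-wide-or-net p = proj₂ (representatives p)

  far-representative : ∀ {x w w′} → Far 3 x w → Far 3 x w′ →
    Σ (Fin 3) λ ι → let s = reps (C x) ι in C s ≡ C x × Far 1 s w × Far 1 s w′
  far-representative {x} {w} {w′} xw xw′ with reps-wide-or-net (C x)
  ... | inj₁ (class , wide) = let ι , sw , sw′ = wide w w′ in ι , class ι , sw , sw′
  ... | inj₂ net = let ι , cs , ¬xs = net x refl in ι , cs , via ¬xs xw , via ¬xs xw′
    where
    via : ∀ {s y} → ¬ Far 2 x s → Far 3 x y → Far 1 s y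
    via {s} ¬xs xy = [ (λ xs → ⊥-elim (¬xs xs)) , (λ sy → sy) ]′ (far-split 2 1 s xy)

  InCell : Fin t → Fin 4 → Fin n → Set
  InCell p zero    z = C z ≡ p
  InCell p (suc ι) z = C z ≡ p × ¬ Far 2 z (reps p ι)

  inCell? : ∀ p κ → Decidable (InCell p κ)
  inCell? p zero    z = C z ≟ p
  inCell? p (suc ι) z = C z ≟ p ×-dec ¬? (far? 2 z (reps p ι))

  cell : Fin t → Fin 4 → Subset n
  cell p κ = toSubset (inCell? p κ)

  cell-class : ∀ {p} κ {z} → z ∈ cell p κ → C z ≡ p
  cell-class zero    z∈ = ∈-toSubset⁻ (inCell? _ zero) z∈
  cell-class (suc ι) z∈ = proj₁ (∈-toSubset⁻ (inCell? _ (suc ι)) z∈)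

  RepsAgree : (Fin n → Fin n → Bool) → Fin n → Fin n → Set
  RepsAgree E v v′ = ∀ p ι → E (reps p ι) v ≡ E (reps p ι) v′

  module _ {E : Fin n → Fin n → Bool} (det : ClassDeterminacy.ClassDetermined F C E) where

    repsAgree⇒agree-far : ∀ {x v v′} → RepsAgree E v v′ → Far 3 x v → Far 3 x v′ → E x v ≡ E x v′
    repsAgree⇒agree-far {x} {v} {v′} agree xv xv′ with far-representative xv xv′
    ... | ι , cs , sv , sv′ = begin
      E x v  ≡⟨ det (far-antitone (s≤s z≤n) xv) sv (sym cs) refl ⟩
      E s v  ≡⟨ agree (C x) ι ⟩
      E s v′ ≡⟨ det sv′ (far-antitone (s≤s z≤n) xv′) cs refl ⟩
      E x v′ ∎
      where
      open ≡-Reasoning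
      s = reps (C x) ι

    home-cell : ∀ {u v v′} → RepsAgree E v v′ → Far 5 u v → Far 2 v v′ →
      Σ (Fin 4) λ κ → u ∈ cell (C u) κ × (∀ a → a ∈ cell (C u) κ → E a v ≡ E u v ⊎ E a v′ ≡ E u v)
    home-cell {u} {v} {v′} agree uv vv′ with reps-wide-or-net (C u)
    ... | inj₁ (class , wide) =
      zero , ∈-toSubset⁺ (inCell? (C u) zero) refl , λ a a∈ → part-agrees (cell-class zero a∈)
      where
      part-agrees : ∀ {a} → C a ≡ C u → E a v ≡ E u v ⊎ E a v′ ≡ E u v
      part-agrees {a} ca with far-from-one-of vv′ a | wide v v′
      ... | inj₁ va  | _ = inj₁ (det (far-sym va) (far-antitone (s≤s z≤n) uv) ca refl)
      ... | inj₂ v′a | ι , sv , sv′ = inj₂ (begin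
        E a v′ ≡⟨ det (far-sym v′a) sv′ (trans ca (sym (class ι))) refl ⟩
        E s v′ ≡⟨ agree (C u) ι ⟨
        E s v  ≡⟨ det sv (far-antitone (s≤s z≤n) uv) (class ι) refl ⟩
        E u v  ∎)
        where
        open ≡-Reasoning
        s = reps (C u) ι
    ... | inj₂ net with net u refl
    ...   | ι , _ , ¬us = suc ι , ∈-toSubset⁺ (inCell? (C u) (suc ι)) (refl , ¬us) , ball-agrees
      where
      ball-agrees : ∀ a → a ∈ cell (C u) (suc ι) → E a v ≡ E u v ⊎ E a v′ ≡ E u v
      ball-agrees a a∈ with ∈-toSubset⁻ (inCell? (C u) (suc ι)) a∈ | far-split 4 1 a uv
      ... | _  , ¬as | inj₁ ua = ⊥-elim (near-trans 2 2 ¬us (¬as ∘ far-sym) ua)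
      ... | ca , _   | inj₂ av = inj₁ (det av (far-antitone (s≤s z≤n) uv) ca refl)

module SeparatingSet {n t k} (F : Farness n) (C : Fin n → Fin t) (x₀ : Fin n)
  (E : Fin n → Fin n → Bool) (det : ClassDeterminacy.ClassDetermined F C E) (dual : ∀ A B → HasDuality E A B k) where
  open Farness F
  open ClassDeterminacy F C
  open Cells F C x₀

  W : Fin t → Fin 4 → Fin t → Fin 4 → Subset n
  W p κ q κ′ = witness (dual (cell p κ) (cell q κ′))

  block : Fin t → Fin t → Subset n
  block p q = ⋃ᶠ (λ ι → ⁅ reps p ι ⁆) ∪ ⋃ᶠ (λ κ → ⋃ᶠ (λ κ′ → W p κ q κ′))

  S : Subset n
  S = ⋃ᶠ λ p → ⋃ᶠ λ q → block p q

  block⊆S : ∀ p q → block p q ⊆ S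
  block⊆S p q = f⊆⋃ᶠf (λ p → ⋃ᶠ (block p)) p ∘ f⊆⋃ᶠf (block p) q

  reps∈S : ∀ p ι → reps p ι ∈ S
  reps∈S p ι = block⊆S p p (p⊆p∪q _ (f⊆⋃ᶠf (λ ι → ⁅ reps p ι ⁆) ι (x∈⁅x⁆ (reps p ι))))

  W⊆S : ∀ p κ q κ′ → W p κ q κ′ ⊆ S
  W⊆S p κ q κ′ = block⊆S p q ∘ q⊆p∪q (⋃ᶠ (λ ι → ⁅ reps p ι ⁆)) _
    ∘ f⊆⋃ᶠf (λ κ → ⋃ᶠ (W p κ q)) κ ∘ f⊆⋃ᶠf (W p κ q) κ′

  ∣block∣≤ : ∀ p q → ∣ block p q ∣ ≤ 3 * 1 + 4 * (4 * k)
  ∣block∣≤ p q = ℕ.≤-trans (∣p∪q∣≤∣p∣+∣q∣ (⋃ᶠ (λ ι → ⁅ reps p ι ⁆)) (⋃ᶠ (λ κ → ⋃ᶠ (W p κ q)))) (ℕ.+-mono-≤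
    (∣⋃ᶠ∣≤ (λ ι → ⁅ reps p ι ⁆) λ ι → ℕ.≤-reflexive (∣⁅x⁆∣≡1 (reps p ι)))
    (∣⋃ᶠ∣≤ (λ κ → ⋃ᶠ (W p κ q)) λ κ → ∣⋃ᶠ∣≤ (W p κ q) λ κ′ → ∣witness∣≤k (dual (cell p κ) (cell q κ′))))

  ∣S∣≤ : ∣ S ∣ ≤ 19 * k * t * t
  ∣S∣≤ = begin
    ∣ S ∣                           ≤⟨ ∣⋃ᶠ∣≤ (λ p → ⋃ᶠ (block p)) (λ p → ∣⋃ᶠ∣≤ (block p) (∣block∣≤ p)) ⟩
    t * (t * (3 * 1 + 4 * (4 * k))) ≤⟨ ℕ.*-monoʳ-≤ t (ℕ.*-monoʳ-≤ t (ℕ.+-monoˡ-≤ (4 * (4 * k)) (ℕ.*-monoʳ-≤ 3 0<k))) ⟩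
    t * (t * (3 * k + 4 * (4 * k))) ≡⟨ arithmetic k t ⟩
    19 * k * t * t                  ∎
    where
    open ℕ.≤-Reasoning
    0<k : 0 < k
    0<k = duality-order-positive x₀ (dual ⊤ ⊤)
    arithmetic : ∀ k t → t * (t * (3 * k + 4 * (4 * k))) ≡ 19 * k * t * t
    arithmetic = solve-∀

  AgreeOnS : (Fin n → Fin n → Bool) → Fin n → Fin n → Set
  AgreeOnS E′ v v′ = ∀ s → s ∈ S → E′ s v ≡ E′ s v′

  agreeOnS⇒repsAgree : ∀ E′ {v v′} → AgreeOnS E′ v v′ → RepsAgree E′ v v′
  agreeOnS⇒repsAgree _ agree p ι = agree (reps p ι) (reps∈S p ι)

  agreeOnS-sym : ∀ E′ {v v′} → AgreeOnS E′ v v′ → AgreeOnS E′ v′ v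
  agreeOnS-sym _ agree s s∈S = sym (agree s s∈S)

  mismatch-impossible : ∀ {u v u′ v′} → AgreeOnS (flip E) u u′ → AgreeOnS E v v′ →
    Far 5 u v → Far 5 u′ v′ → Far 2 u u′ → Far 2 v v′ → E u v ≡ true → E u′ v′ ≡ false → ⊥
  mismatch-impossible {u} {v} {u′} {v′} rows cols uv u′v′ uu′ vv′ Euv Eu′v′
    with home-cell det (agreeOnS⇒repsAgree E cols) uv vv′
       | home-cell (transpose-classDetermined det) (agreeOnS⇒repsAgree (flip E) (agreeOnS-sym (flip E) rows)) (far-sym u′v′) (far-sym uu′)
  ... | κ , u∈A , A-agrees | κ′ , v′∈B , B-agrees
    with witness-separates (dual (cell (C u) κ) (cell (C v′) κ′))
  ... | inj₁ sep = let a , a∈W , a∈A , Eav′ = sep v′ v′∈B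
                       Eav = trans (cols a (W⊆S _ κ _ κ′ a∈W)) Eav′
                   in true≢false (trans (sym Euv) (common-value (A-agrees a a∈A) Eav Eav′))
  ... | inj₂ sep = let b , b∈W , b∈B , Eub = sep u u∈A
                       Eu′b = trans (sym (rows b (W⊆S _ κ _ κ′ b∈W))) Eub
                   in true≢false (trans (sym (common-value (B-agrees b b∈B) Eu′b Eub)) Eu′v′)

  columns-agree : ∀ {x v v′} → AgreeOnS E v v′ → Far 3 x v → Far 3 x v′ → E x v ≡ E x v′
  columns-agree cols = repsAgree⇒agree-far det (agreeOnS⇒repsAgree E cols)

  rows-agree : ∀ {u u′ y} → AgreeOnS (flip E) u u′ → Far 3 u y → Far 3 u′ y → E u y ≡ E u′ y
  rows-agree rows uy u′y = repsAgree⇒agree-far (transpose-classDetermined det)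
    (agreeOnS⇒repsAgree (flip E) rows) (far-sym uy) (far-sym u′y)

  3≤5 : 3 ≤ 5
  3≤5 = ℕ.m≤m+n 3 2

  separates : ∀ u v u′ v′ → Far 5 u v → Far 5 u′ v′ →
    AgreeOnS (flip E) u u′ → AgreeOnS E v v′ → E u v ≡ E u′ v′
  separates u v u′ v′ uv u′v′ rows cols with far? 3 u v′ | far? 3 u′ v
  ... | yes uv′ | _       = trans (columns-agree cols (far-antitone 3≤5 uv) uv′) (rows-agree rows uv′ (far-antitone 3≤5 u′v′))
  ... | no _    | yes u′v = trans (rows-agree rows (far-antitone 3≤5 uv) u′v) (columns-agree cols u′v (far-antitone 3≤5 u′v′))
  ... | no ¬uv′ | no ¬u′v with far-split 2 3 u′ uv | far-split 3 2 v′ uv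
  ...   | inj₂ u′v | _        = ⊥-elim (¬u′v u′v)
  ...   | _        | inj₁ uv′ = ⊥-elim (¬uv′ uv′)
  ...   | inj₁ uu′ | inj₂ v′v with E u v in Euv | E u′ v′ in Eu′v′
  ...     | true  | true  = refl
  ...     | false | false = refl
  ...     | true  | false = ⊥-elim (mismatch-impossible rows cols uv u′v′ uu′ (far-sym v′v) Euv Eu′v′)
  ...     | false | true  = ⊥-elim (mismatch-impossible (agreeOnS-sym (flip E) rows) (agreeOnS-sym E cols) u′v′ uv (far-sym uu′) v′v Eu′v′ Euv)

theorem3p5 : Σ ℕ λ c →
  (r k t n : ℕ) (E : Fin n → Fin n → Bool) (dist : Fin n → Fin n → ℚ∞) (C : Fin n → Fin t) →
  (∀ A B → HasDuality E A B k) →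
  IsPseudometric dist →
  (∀ u v u' v' → ℕ→ℚ r <∞ dist u v → ℕ→ℚ r <∞ dist u' v' →
    C u ≡ C u' → C v ≡ C v' → E u v ≡ E u' v') →
  Σ (Subset n) λ S → ∣ S ∣ ≤ c * k * t * t ×
    (∀ u v u' v' → ℕ→ℚ (5 * r) <∞ dist u v → ℕ→ℚ (5 * r) <∞ dist u' v' →
      (∀ s → s ∈ S → E u s ≡ E u' s) → (∀ s → s ∈ S → E s v ≡ E s v') →
      E u v ≡ E u' v')
theorem3p5 = 19 , λ where
  r k t zero    E dist C dual pm det → [] , z≤n , λ ()
  r k t (suc n) E dist C dual pm det →
    let open SeparatingSet (pseudometricFarness pm r) C zero E
               (λ xy x′y′ → det _ _ _ _ (far₁⇒r<dist pm r xy) (far₁⇒r<dist pm r x′y′)) dual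
    in S , ∣S∣≤ , separates
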